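{- If $P$ is a graph with $r(P)=2$, then $\mathrm{cov}_{AB}(P)\neq 2$.
   Context: All graphs are finite and simple. Distances are in $P$; for a vertex $p$ and vertex set $S$, $d(p,S)=d(S,p)=\min_{s\in S}d(s,p)$. Radius $r$ is the minimum eccentricity. A covering of $P$ is a family $\{P_1,\dots,P_k\}$ of subsets of $V(P)$ with $\bigcup P_i=V(P)$; $k$ is its size. Condition A: for each $i$ there is $p\notin P_i$ with $d(P_i,p)\geq 2$. Condition B: for every $i$ and every $p\in P_i$, either there is $p'\notin P_i$ with $d(p,p')\geq 3$, or there is $j\neq i$ with $d(p,P_j)\geq 2$. $\mathrm{cov}_{AB}(P)$ is the smallest size of a covering of $P$ satisfying both conditions A and B. -}

module Defs where

open import Level using (0ℓ)
open import Data.Nat using (ℕ; zero; suc; _≤_; _<_)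
open import Data.Fin using (Fin)
open import Data.Fin.Subset using (Subset; _∈_; _∉_)
open import Data.Product using (Σ; ∃; ∃-syntax; _×_; _,_)
open import Relation.Nullary using (¬_)
open import Data.Sum using (_⊎_)
open import Relation.Binary.PropositionalEquality using (_≡_)

record Graph : Set₁ where
  field
    n    : ℕ
    Adj  : Fin n → Fin n → Set
    sym  : ∀ {u v} → Adj u v → Adj v u
    irr  : ∀ {u} → ¬ Adj u u

open Graph public

data Walk (P : Graph) : Fin (n P) → Fin (n P) → ℕ → Set where
  here : ∀ {u} → Walk P u u zero
  step : ∀ {u v w k} → Adj P u v → Walk P v w k → Walk P u w (suc k)

-- d(u,v) ≤ k : there is a walk from u to v of length at most k
-- (d is the shortest-walk distance, possibly infinite).
dist≤ : (P : Graph) → Fin (n P) → Fin (n P) → ℕ → Set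
dist≤ P u v k = ∃[ j ] (j ≤ k × Walk P u v j)

-- d(u,v) ≥ k  (k ≥ 1) is ¬ (d(u,v) ≤ k - 1); we write it via suc.
dist≥suc : (P : Graph) → Fin (n P) → Fin (n P) → ℕ → Set
dist≥suc P u v k = ¬ dist≤ P u v k

-- Radius r(P) = min over v of max over u of d(v,u).  r(P) = 2 means:
-- some vertex has eccentricity ≤ 2, and every vertex has eccentricity ≥ 2.
RadiusIs2 : Graph → Set
RadiusIs2 P =
  (∃[ v ] (∀ u → dist≤ P v u 2)) ×
  (∀ v → ∃[ u ] dist≥suc P v u 1)

Family : Graph → ℕ → Set
Family P k = Fin k → Subset (n P)

Covering : (P : Graph) (k : ℕ) → Family P k → Set
Covering P k F = ∀ (p : Fin (n P)) → ∃[ i ] (p ∈ F i)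

setDist≥2 : (P : Graph) → Subset (n P) → Fin (n P) → Set
setDist≥2 P S p = ∀ s → s ∈ S → dist≥suc P s p 1

ConditionA : (P : Graph) (k : ℕ) → Family P k → Set
ConditionA P k F = ∀ i → ∃[ p ] (p ∉ F i × setDist≥2 P (F i) p)

ConditionB : (P : Graph) (k : ℕ) → Family P k → Set
ConditionB P k F = ∀ i → ∀ p → p ∈ F i →
  (∃[ p' ] (p' ∉ F i × dist≥suc P p p' 2))
  ⊎
  (∃[ j ] (¬ (j ≡ i) × setDist≥2 P (F j) p))

HasCovAB : (P : Graph) → ℕ → Set
HasCovAB P k = ∃[ F ] (Covering P k F × ConditionA P k F × ConditionB P k F)

CovABIs : Graph → ℕ → Set
CovABIs P k = HasCovAB P k × (∀ m → m < k → ¬ HasCovAB P m)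

-- A vertex v of eccentricity at most 2 rules out every AB-covering {F₀, F₁}.
-- Say v ∈ F i. Condition B at v cannot use a vertex at distance ≥ 3 from v,
-- so the other set F j stays at distance ≥ 2 from v. Condition A for F i gives
-- p ∉ F i at distance ≥ 2 from F i, and a path v – w – p of length ≤ 2 exists;
-- w ∈ F i brings F i within distance 1 of p, and w ∈ F j brings F j within
-- distance 1 of v.
module Submission where

open import Defs
open import Data.Nat using (zero; suc; z≤n; s≤s)
open import Data.Fin using (Fin; zero; suc; _≟_)
open import Data.Fin.Subset using (_∈_; _∉_)
open import Data.Fin.Subset.Properties using (_∈?_)
open import Data.Product using (∃-syntax; _×_; _,_)
open import Data.Sum using (_⊎_; inj₁; inj₂)
open import Relation.Nullary using (¬_; yes; no; contradiction)
open import Relation.Binary.PropositionalEquality using (_≡_; _≢_; refl)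

≢-≢⇒≡ : {a b c : Fin 2} → a ≢ c → b ≢ c → a ≡ b
≢-≢⇒≡ {zero}     {zero}     _   _   = refl
≢-≢⇒≡ {suc zero} {suc zero} _   _   = refl
≢-≢⇒≡ {zero}     {suc zero} {zero}     a≢c _   = contradiction refl a≢c
≢-≢⇒≡ {zero}     {suc zero} {suc zero} _   b≢c = contradiction refl b≢c
≢-≢⇒≡ {suc zero} {zero}     {zero}     _   b≢c = contradiction refl b≢c
≢-≢⇒≡ {suc zero} {zero}     {suc zero} a≢c _   = contradiction refl a≢c

covering₂-∉⇒∈ : (P : Graph) (F : Family P 2) → Covering P 2 F →
                {i j : Fin 2} → j ≢ i → ∀ {w} → w ∉ F i → w ∈ F j
covering₂-∉⇒∈ P F cover {i} j≢i {w} w∉Fi with cover w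
... | k , w∈Fk with k ≟ i
...   | yes refl = contradiction w∈Fk w∉Fi
...   | no k≢i with ≢-≢⇒≡ k≢i j≢i
...     | refl = w∈Fk

adjacent⇒dist≤1 : (P : Graph) {u v : Fin (n P)} → Adj P u v → dist≤ P u v 1
adjacent⇒dist≤1 P uv = 1 , s≤s z≤n , step uv here

dist≤2-cases : (P : Graph) {u v : Fin (n P)} → dist≤ P u v 2 →
               u ≡ v ⊎ Adj P u v ⊎ ∃[ w ] (Adj P u w × Adj P w v)
dist≤2-cases P (_ , _ , here)                        = inj₁ refl
dist≤2-cases P (_ , _ , step uv here)                = inj₂ (inj₁ uv)
dist≤2-cases P (_ , _ , step uw (step wv here))      = inj₂ (inj₂ (_ , uw , wv))
dist≤2-cases P (_ , s≤s (s≤s ()) , step _ (step _ (step _ _)))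

covering₂-separates : (P : Graph) (F : Family P 2) → Covering P 2 F →
                      {i j : Fin 2} → j ≢ i → {v p : Fin (n P)} →
                      v ∈ F i → setDist≥2 P (F j) v →
                      p ∉ F i → setDist≥2 P (F i) p →
                      ¬ dist≤ P v p 2
covering₂-separates P F cover {i} j≢i v∈Fi Fj-far p∉Fi Fi-far v-p
  with dist≤2-cases P v-p
... | inj₁ refl             = p∉Fi v∈Fi
... | inj₂ (inj₁ vp)        = Fi-far _ v∈Fi (adjacent⇒dist≤1 P vp)
... | inj₂ (inj₂ (w , vw , wp)) with w ∈? F i
...   | yes w∈Fi = Fi-far w w∈Fi (adjacent⇒dist≤1 P wp)
...   | no w∉Fi  = Fj-far w (covering₂-∉⇒∈ P F cover j≢i w∉Fi)
                            (adjacent⇒dist≤1 P (sym P vw))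

eccentricity≤2⇒¬HasCovAB₂ : (P : Graph) (v : Fin (n P)) →
                            (∀ u → dist≤ P v u 2) → ¬ HasCovAB P 2
eccentricity≤2⇒¬HasCovAB₂ P v ecc (F , cover , condA , condB)
  with cover v
... | i , v∈Fi with condB i v v∈Fi
...   | inj₁ (p' , _ , v-p'-far) = v-p'-far (ecc p')
...   | inj₂ (j , j≢i , Fj-far) with condA i
...     | p , p∉Fi , Fi-far =
  covering₂-separates P F cover j≢i v∈Fi Fj-far p∉Fi Fi-far (ecc p)

proposition5p3 : (P : Graph) → RadiusIs2 P → ¬ CovABIs P 2
proposition5p3 P ((v , ecc) , _) (hasCov , _) =
  eccentricity≤2⇒¬HasCovAB₂ P v ecc hasCov
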